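{- Let $L$ be a finite graded lattice with a maximal chain $\hat0=x_0\prec x_1\prec\dots\prec x_r=\hat1$ of left modular elements, and let $\mathbf y$ be a chain in $L$. Let $t\ge1$. Let $a_1\ge a_2\ge\dots\ge a_t$ be a decreasing sequence of elements of $\{x_0,\dots,x_r\}$, and let $b_1\le b_2\le\dots\le b_t$ be an increasing sequence of elements of $\mathbf y$. Then $$(b_1\vee a_1)\wedge(b_2\vee a_2)\wedge\dots\wedge(b_t\vee a_t)=b_1\vee(a_1\wedge b_2)\vee\dots\vee(a_{t-1}\wedge b_t)\vee a_t$$ and $$(a_1\wedge b_1)\vee(a_2\wedge b_2)\vee\dots\vee(a_t\wedge b_t)=a_1\wedge(b_1\vee a_2)\wedge\dots\wedge(b_{t-1}\vee a_t)\wedge b_t.$$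
   Context: A lattice is graded if, whenever $x<y$ and there is a finite maximal chain between $x$ and $y$, all maximal chains between $x$ and $y$ have the same length. An element $x$ is left modular if $(y\vee x)\wedge z=y\vee(x\wedge z)$ for all $y\le z$. The notation $a\prec b$ means that $b$ covers $a$. -}

module Defs where

open import Level using (Level; _⊔_)
open import Data.Nat using (ℕ; zero; suc)
open import Data.Fin using (Fin; zero; suc; fromℕ; inject₁)
import Data.Fin as F
open import Data.Product using (Σ; ∃; _×_)
open import Data.Sum using (_⊎_)
open import Relation.Nullary using (¬_)
open import Relation.Binary.PropositionalEquality using (_≡_)
open import Relation.Binary.Lattice.Bundles using (Lattice)

module LatticeDefs {c ℓ₁ ℓ₂} (L : Lattice c ℓ₁ ℓ₂) where
  open Lattice L public

  _<_ : Carrier → Carrier → Set (ℓ₁ ⊔ ℓ₂)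
  u < v = (u ≤ v) × ¬ (u ≈ v)

  _≺_ : Carrier → Carrier → Set (c ⊔ ℓ₁ ⊔ ℓ₂)
  u ≺ v = (u < v) × (∀ z → u ≤ z → z ≤ v → (z ≈ u) ⊎ (z ≈ v))

  IsFinite : Set (c ⊔ ℓ₁)
  IsFinite = Σ ℕ λ n → Σ (Fin n → Carrier) λ f → ∀ u → ∃ λ i → f i ≈ u

  -- a maximal chain u = c₀ ≺ c₁ ≺ ... ≺ c_k = v of length k
  -- (in a finite lattice the maximal chains of [u,v] are exactly the
  --  saturated chains, i.e. chains of successive covers)
  MaxChain : Carrier → Carrier → ℕ → Set (c ⊔ ℓ₁ ⊔ ℓ₂)
  MaxChain u v k = Σ (Fin (suc k) → Carrier) λ ch →
    (ch zero ≈ u) × (ch (fromℕ k) ≈ v) × (∀ (i : Fin k) → ch (inject₁ i) ≺ ch (suc i))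

  IsGraded : Set (c ⊔ ℓ₁ ⊔ ℓ₂)
  IsGraded = ∀ u v → u < v → ∀ k m → MaxChain u v k → MaxChain u v m → k ≡ m

  IsLeftModular : Carrier → Set (c ⊔ ℓ₁ ⊔ ℓ₂)
  IsLeftModular x = ∀ y z → y ≤ z → ((y ∨ x) ∧ z) ≈ (y ∨ (x ∧ z))

  IsChain : ∀ {p} → (Carrier → Set p) → Set (c ⊔ ℓ₂ ⊔ p)
  IsChain Y = ∀ u v → Y u → Y v → (u ≤ v) ⊎ (v ≤ u)

  IsMaxLeftModularChain : (r : ℕ) → (Fin (suc r) → Carrier) → Set (c ⊔ ℓ₁ ⊔ ℓ₂)
  IsMaxLeftModularChain r x =
    (∀ z → x zero ≤ z) × (∀ z → z ≤ x (fromℕ r)) ×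
    (∀ (i : Fin r) → x (inject₁ i) ≺ x (suc i)) × (∀ i → IsLeftModular (x i))

  meetPairs : ∀ n → (Fin (suc n) → Carrier) → (Fin (suc n) → Carrier) → Carrier
  meetPairs zero    a b = b zero ∨ a zero
  meetPairs (suc n) a b = (b zero ∨ a zero) ∧ meetPairs n (λ i → a (suc i)) (λ i → b (suc i))

  joinPairs : ∀ n → (Fin (suc n) → Carrier) → (Fin (suc n) → Carrier) → Carrier
  joinPairs zero    a b = a zero ∧ b zero
  joinPairs (suc n) a b = (a zero ∧ b zero) ∨ joinPairs n (λ i → a (suc i)) (λ i → b (suc i))

  shiftJoin : ∀ n → (Fin (suc n) → Carrier) → (Fin (suc n) → Carrier) → Carrier
  shiftJoin zero    a b = a zero
  shiftJoin (suc n) a b = (a zero ∧ b (suc zero)) ∨ shiftJoin n (λ i → a (suc i)) (λ i → b (suc i))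

  shiftMeet : ∀ n → (Fin (suc n) → Carrier) → (Fin (suc n) → Carrier) → Carrier
  shiftMeet zero    a b = b zero
  shiftMeet (suc n) a b = (b zero ∨ a (suc zero)) ∧ shiftMeet n (λ i → a (suc i)) (λ i → b (suc i))

-- For consecutive elements x ≺ x′ of the chain and any w, left modularity of x and x′ makes
-- each of the steps x ∧ w ≤ x′ ∧ w and w ∨ x ≤ w ∨ x′ an equality or a cover, and at most
-- one of them is a cover. The walk x₀ ∧ w, …, x_r ∧ w = w = w ∨ x₀, …, w ∨ x_r is then a
-- maximal chain from 0̂ to 1̂, of length r by gradedness, so for every k exactly one of the
-- two steps is a cover; either way x′ ∧ (w ∨ x) = (x′ ∧ w) ∨ x. Left modularity propagates
-- this modular law to all pairs x_i ≤ x_j, and from it and left modularity of the a_i both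
-- identities follow by induction on t.
module Submission where

open import Defs
open import Data.Nat using (ℕ; suc)
open import Data.Fin using (Fin)
import Data.Fin as F
open import Data.Product using (∃; _×_)
open import Relation.Binary.Lattice.Bundles using (Lattice)

open import Level using (_⊔_)
import Data.Nat as ℕ
open import Data.Nat.Properties using (+-mono-≤; +-mono-≤-<; +-assoc; +-identityʳ; <-irrefl)
open import Data.Fin using (zero; suc; fromℕ; inject₁)
open import Data.Fin.Properties using (≤-total)
open import Data.Product using (_,_; proj₁; proj₂)
open import Data.Sum using (_⊎_; inj₁; inj₂; [_,_]′)
open import Data.Empty using (⊥-elim)
open import Function using (_∘_; id)
open import Relation.Nullary using (¬_)
open import Relation.Binary.PropositionalEquality as ≡ using (_≡_)
open import Algebra.Properties.CommutativeMonoid.Sum Data.Nat.Properties.+-0-commutativeMonoid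
  using (sum; ∑-distrib-+)
import Relation.Binary.Lattice.Properties.JoinSemilattice as JoinProperties
import Relation.Binary.Lattice.Properties.MeetSemilattice as MeetProperties
import Relation.Binary.Reasoning.Setoid as SetoidReasoning
import Relation.Binary.Reasoning.PartialOrder as PosetReasoning

sum≤length : ∀ {n} (f : Fin n → ℕ) → (∀ i → f i ℕ.≤ 1) → sum f ℕ.≤ n
sum≤length {ℕ.zero} f f≤1 = ℕ.z≤n
sum≤length {suc n}  f f≤1 = +-mono-≤ (f≤1 zero) (sum≤length (f ∘ suc) (f≤1 ∘ suc))

sum<length : ∀ {n} (f : Fin n → ℕ) → (∀ i → f i ℕ.≤ 1) → ∀ k → f k ≡ 0 → sum f ℕ.< n
sum<length f f≤1 zero f₀≡0 rewrite f₀≡0 = ℕ.s≤s (sum≤length (f ∘ suc) (f≤1 ∘ suc))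
sum<length f f≤1 (suc k) fₖ≡0 = +-mono-≤-< (f≤1 zero) (sum<length (f ∘ suc) (f≤1 ∘ suc) k fₖ≡0)

module LeftModularChain {c ℓ₁ ℓ₂} (L : Lattice c ℓ₁ ℓ₂) where
  open LatticeDefs L
  open JoinProperties joinSemilattice using (∨-monotonic; ∨-cong; ∨-assoc)
  open MeetProperties meetSemilattice using (∧-monotonic; ∧-cong; ∧-assoc)
  module ≈-Reasoning = SetoidReasoning setoid
  module ≤-Reasoning = PosetReasoning poset

  IsModularTriple : Carrier → Carrier → Carrier → Set ℓ₂
  IsModularTriple s w t = t ∧ (w ∨ s) ≤ (t ∧ w) ∨ s

  modular-inequality : ∀ {s w t} → s ≤ t → (t ∧ w) ∨ s ≤ t ∧ (w ∨ s)
  modular-inequality s≤t = ∨-least (∧-monotonic refl (x≤x∨y _ _)) (∧-greatest s≤t (y≤x∨y _ _))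

  IsModularTriple⇒≈ : ∀ {s w t} → s ≤ t → IsModularTriple s w t → t ∧ (w ∨ s) ≈ (t ∧ w) ∨ s
  IsModularTriple⇒≈ s≤t modular = antisym modular (modular-inequality s≤t)

  ≥⇒IsModularTriple : ∀ {s w t} → t ≤ s → IsModularTriple s w t
  ≥⇒IsModularTriple t≤s = trans (x∧y≤x _ _) (trans t≤s (y≤x∨y _ _))

  IsModularTriple-resp-≈ : ∀ {s s′ w t t′} → s ≈ s′ → t ≈ t′ →
                           IsModularTriple s w t → IsModularTriple s′ w t′
  IsModularTriple-resp-≈ {s} {s′} {w} {t} {t′} s≈s′ t≈t′ modular = begin
    t′ ∧ (w ∨ s′)  ≈⟨ ∧-cong (Eq.sym t≈t′) (∨-cong Eq.refl (Eq.sym s≈s′)) ⟩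
    t ∧ (w ∨ s)    ≤⟨ modular ⟩
    (t ∧ w) ∨ s    ≈⟨ ∨-cong (∧-cong t≈t′ Eq.refl) s≈s′ ⟩
    (t′ ∧ w) ∨ s′  ∎
    where open ≤-Reasoning

  IsModularTriple-trans : ∀ {s t t′ w} → s ≤ t → t ≤ t′ → IsLeftModular t →
                          IsModularTriple s w t → IsModularTriple t w t′ → IsModularTriple s w t′
  IsModularTriple-trans {s} {t} {t′} {w} s≤t t≤t′ t-leftModular s-t t-t′ = begin
    t′ ∧ (w ∨ s)              ≤⟨ ∧-greatest (trans (∧-monotonic refl (∨-monotonic refl s≤t)) t-t′)
                                            (x∧y≤y _ _) ⟩
    ((t′ ∧ w) ∨ t) ∧ (w ∨ s)  ≈⟨ t-leftModular (t′ ∧ w) (w ∨ s) (trans (x∧y≤y _ _) (x≤x∨y _ _)) ⟩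
    (t′ ∧ w) ∨ (t ∧ (w ∨ s))  ≤⟨ ∨-monotonic refl s-t ⟩
    (t′ ∧ w) ∨ ((t ∧ w) ∨ s)  ≤⟨ ∨-least (x≤x∨y _ _) (∨-monotonic (∧-monotonic t≤t′ refl) refl) ⟩
    (t′ ∧ w) ∨ s              ∎
    where open ≤-Reasoning

  IsLeftModular-resp-≈ : ∀ {x x′} → x ≈ x′ → IsLeftModular x → IsLeftModular x′
  IsLeftModular-resp-≈ {x} {x′} x≈x′ x-leftModular y z y≤z = begin
    (y ∨ x′) ∧ z  ≈⟨ ∧-cong (∨-cong Eq.refl (Eq.sym x≈x′)) Eq.refl ⟩
    (y ∨ x) ∧ z   ≈⟨ x-leftModular y z y≤z ⟩
    y ∨ (x ∧ z)   ≈⟨ ∨-cong Eq.refl (∧-cong x≈x′ Eq.refl) ⟩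
    y ∨ (x′ ∧ z)  ∎
    where open ≈-Reasoning

  ≺⇒≱ : ∀ {u v} → u ≺ v → ¬ (v ≤ u)
  ≺⇒≱ ((u≤v , u≉v) , _) v≤u = u≉v (antisym u≤v v≤u)

  ≺-respʳ-≈ : ∀ {u v v′} → v ≈ v′ → u ≺ v → u ≺ v′
  ≺-respʳ-≈ v≈v′ ((u≤v , u≉v) , between) =
    (trans u≤v (reflexive v≈v′) , λ u≈v′ → u≉v (Eq.trans u≈v′ (Eq.sym v≈v′))) ,
    λ z u≤z z≤v′ → Data.Sum.map₂ (λ z≈v → Eq.trans z≈v v≈v′)
                                 (between z u≤z (trans z≤v′ (reflexive (Eq.sym v≈v′))))

  data Step (u v : Carrier) : ℕ → Set (c ⊔ ℓ₁ ⊔ ℓ₂) where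
    stay  : u ≈ v → Step u v 0
    climb : u ≺ v → Step u v 1

  MaxChain-refl : ∀ {u} → MaxChain u u 0
  MaxChain-refl {u} = (λ _ → u) , Eq.refl , Eq.refl , λ ()

  MaxChain-respˡ : ∀ {u u′ v k} → u ≈ u′ → MaxChain u v k → MaxChain u′ v k
  MaxChain-respˡ u≈u′ (ch , start , end , covers) = ch , Eq.trans start u≈u′ , end , covers

  MaxChain-respʳ : ∀ {u v v′ k} → v ≈ v′ → MaxChain u v k → MaxChain u v′ k
  MaxChain-respʳ v≈v′ (ch , start , end , covers) = ch , start , Eq.trans end v≈v′ , covers

  Step-prepend : ∀ {u v z d n} → Step u v d → MaxChain v z n → MaxChain u z (d ℕ.+ n)
  Step-prepend (stay u≈v) chain = MaxChain-respˡ (Eq.sym u≈v) chain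
  Step-prepend {u} (climb u≺v) (ch , start , end , covers) =
    (λ { zero → u ; (suc i) → ch i }) , Eq.refl , end ,
    λ { zero → ≺-respʳ-≈ (Eq.sym start) u≺v ; (suc i) → covers i }

  Steps-prepend : ∀ {m z n} (s : Fin (suc m) → Carrier) (d : Fin m → ℕ) →
                  (∀ k → Step (s (inject₁ k)) (s (suc k)) (d k)) →
                  MaxChain (s (fromℕ m)) z n → MaxChain (s zero) z (sum d ℕ.+ n)
  Steps-prepend {ℕ.zero} s d steps chain = chain
  Steps-prepend {suc m} {z} {n} s d steps chain =
    ≡.subst (MaxChain (s zero) z) (≡.sym (+-assoc (d zero) (sum (d ∘ suc)) n))
      (Step-prepend (steps zero) (Steps-prepend (s ∘ suc) (d ∘ suc) (steps ∘ suc) chain))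

  record CoverSplit (s t w : Carrier) : Set (c ⊔ ℓ₁ ⊔ ℓ₂) where
    field
      lowerLength upperLength : ℕ
      lower        : Step (s ∧ w) (t ∧ w) lowerLength
      upper        : Step (w ∨ s) (w ∨ t) upperLength
      length≤1       : lowerLength ℕ.+ upperLength ℕ.≤ 1
      modular⊎flat : IsModularTriple s w t ⊎ lowerLength ℕ.+ upperLength ≡ 0

  module _ {s t : Carrier} (s≺t : s ≺ t) where
    private
      s≤t : s ≤ t
      s≤t = proj₁ (proj₁ s≺t)

      squeeze : ∀ {z} → s ≤ z → z ≤ t → (z ≈ s) ⊎ (z ≈ t)
      squeeze = proj₂ s≺t _

    meet-stay : ∀ {w} → (t ∧ w) ∨ s ≈ s → s ∧ w ≈ t ∧ w
    meet-stay flat = antisym (∧-monotonic s≤t refl)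
                             (∧-greatest (trans (x≤x∨y _ _) (reflexive flat)) (x∧y≤y _ _))

    join-stay : ∀ {w} → t ∧ (w ∨ s) ≈ t → w ∨ s ≈ w ∨ t
    join-stay full = antisym (∨-monotonic refl s≤t)
                             (∨-least (x≤x∨y _ _) (trans (reflexive (Eq.sym full)) (x∧y≤y _ _)))

    meet-climb : ∀ {w} → IsLeftModular s → (t ∧ w) ∨ s ≈ t → (s ∧ w) ≺ (t ∧ w)
    meet-climb {w} s-leftModular spans = (∧-monotonic s≤t refl , distinct) , between
      where
      open ≤-Reasoning
      distinct : ¬ (s ∧ w ≈ t ∧ w)
      distinct eq = ≺⇒≱ s≺t (begin
        t            ≈⟨ Eq.sym spans ⟩
        (t ∧ w) ∨ s  ≈⟨ ∨-cong (Eq.sym eq) Eq.refl ⟩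
        (s ∧ w) ∨ s  ≤⟨ ∨-least (x∧y≤x _ _) refl ⟩
        s            ∎)
      between : ∀ z → s ∧ w ≤ z → z ≤ t ∧ w → (z ≈ s ∧ w) ⊎ (z ≈ t ∧ w)
      between z lo hi with squeeze {z ∨ s} (y≤x∨y _ _) (∨-least (trans hi (x∧y≤x _ _)) s≤t)
      ... | inj₁ z∨s≈s = inj₁ (antisym (∧-greatest (trans (x≤x∨y _ _) (reflexive z∨s≈s))
                                                   (trans hi (x∧y≤y _ _))) lo)
      ... | inj₂ z∨s≈t = inj₂ (antisym hi (begin
        t ∧ w              ≤⟨ ∧-greatest (trans (x∧y≤x _ _) (reflexive (Eq.sym z∨s≈t))) refl ⟩
        (z ∨ s) ∧ (t ∧ w)  ≈⟨ s-leftModular z (t ∧ w) hi ⟩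
        z ∨ (s ∧ (t ∧ w))  ≤⟨ ∨-least refl (trans (∧-monotonic refl (x∧y≤y _ _)) lo) ⟩
        z                  ∎))

    join-climb : ∀ {w} → IsLeftModular t → t ∧ (w ∨ s) ≈ s → (w ∨ s) ≺ (w ∨ t)
    join-climb {w} t-leftModular meets = (∨-monotonic refl s≤t , distinct) , between
      where
      open ≤-Reasoning
      distinct : ¬ (w ∨ s ≈ w ∨ t)
      distinct eq = ≺⇒≱ s≺t (begin
        t            ≤⟨ ∧-greatest refl (trans (y≤x∨y _ _) (reflexive (Eq.sym eq))) ⟩
        t ∧ (w ∨ s)  ≈⟨ meets ⟩
        s            ∎)
      between : ∀ z → w ∨ s ≤ z → z ≤ w ∨ t → (z ≈ w ∨ s) ⊎ (z ≈ w ∨ t)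
      between z lo hi with squeeze {t ∧ z} (∧-greatest s≤t (trans (y≤x∨y _ _) lo)) (x∧y≤x _ _)
      ... | inj₁ t∧z≈s = inj₁ (antisym (begin
        z                  ≤⟨ ∧-greatest (trans hi (∨-monotonic (x≤x∨y _ _) refl)) refl ⟩
        ((w ∨ s) ∨ t) ∧ z  ≈⟨ t-leftModular (w ∨ s) z lo ⟩
        (w ∨ s) ∨ (t ∧ z)  ≤⟨ ∨-least refl (trans (reflexive t∧z≈s) (y≤x∨y _ _)) ⟩
        w ∨ s              ∎) lo)
      ... | inj₂ t∧z≈t = inj₂ (antisym hi (∨-least (trans (x≤x∨y _ _) lo)
                                                   (trans (reflexive (Eq.sym t∧z≈t)) (x∧y≤y _ _))))

    coverSplit : IsLeftModular s → IsLeftModular t → ∀ w → CoverSplit s t w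
    coverSplit s-leftModular t-leftModular w
      with squeeze {(t ∧ w) ∨ s} (y≤x∨y _ _) (∨-least (x∧y≤x _ _) s≤t)
         | squeeze {t ∧ (w ∨ s)} (∧-greatest s≤t (y≤x∨y _ _)) (x∧y≤x _ _)
    ... | inj₁ flat | inj₂ full = record
      { lowerLength = 0 ; upperLength = 0
      ; lower = stay (meet-stay flat) ; upper = stay (join-stay full)
      ; length≤1 = ℕ.z≤n ; modular⊎flat = inj₂ ≡.refl }
    ... | inj₁ flat | inj₁ meets = record
      { lowerLength = 0 ; upperLength = 1
      ; lower = stay (meet-stay flat) ; upper = climb (join-climb t-leftModular meets)
      ; length≤1 = ℕ.s≤s ℕ.z≤n ; modular⊎flat = inj₁ (trans (reflexive meets) (y≤x∨y _ _)) }
    ... | inj₂ spans | inj₂ full = record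
      { lowerLength = 1 ; upperLength = 0
      ; lower = climb (meet-climb s-leftModular spans) ; upper = stay (join-stay full)
      ; length≤1 = ℕ.s≤s ℕ.z≤n ; modular⊎flat = inj₁ (trans (x∧y≤x _ _) (reflexive (Eq.sym spans))) }
    ... | inj₂ spans | inj₁ meets = ⊥-elim (≺⇒≱ s≺t
      (trans (reflexive (Eq.sym spans)) (trans (modular-inequality s≤t) (reflexive meets))))

  steps⇒IsModularTriple :
    ∀ {m w} (x : Fin (suc m) → Carrier) → (∀ i → IsLeftModular (x i)) →
    (∀ k → x (inject₁ k) ≤ x (suc k) × IsModularTriple (x (inject₁ k)) w (x (suc k))) →
    ∀ {i j} → i F.≤ j → x i ≤ x j × IsModularTriple (x i) w (x j)
  steps⇒IsModularTriple x x-leftModular steps {zero} {zero} _ = refl , ≥⇒IsModularTriple refl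
  steps⇒IsModularTriple {ℕ.zero} x x-leftModular steps {zero} {suc ()} _
  steps⇒IsModularTriple {suc m} x x-leftModular steps {zero} {suc j} _ =
    trans x₀≤x₁ x₁≤xⱼ , IsModularTriple-trans x₀≤x₁ x₁≤xⱼ (x-leftModular (suc zero)) x₀-x₁ x₁-xⱼ
    where
    x₀≤x₁ = proj₁ (steps zero)
    x₀-x₁ = proj₂ (steps zero)
    rest = steps⇒IsModularTriple (x ∘ suc) (x-leftModular ∘ suc) (steps ∘ suc) {zero} {j} ℕ.z≤n
    x₁≤xⱼ = proj₁ rest
    x₁-xⱼ = proj₂ rest
  steps⇒IsModularTriple {suc m} x x-leftModular steps {suc i} {suc j} (ℕ.s≤s i≤j) =
    steps⇒IsModularTriple (x ∘ suc) (x-leftModular ∘ suc) (steps ∘ suc) i≤j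

  record IsModularFamily {p} (M : Carrier → Set p) : Set (c ⊔ ℓ₁ ⊔ ℓ₂ ⊔ p) where
    field
      leftModular : ∀ {s} → M s → IsLeftModular s
      modularPair : ∀ {s t} → M s → M t → s ≤ t → ∀ w → IsModularTriple s w t

  module _ (graded : IsGraded) {r : ℕ} {x : Fin (suc r) → Carrier}
           (chain : IsMaxLeftModularChain r x) where
    private
      x-bottom : ∀ z → x zero ≤ z
      x-bottom = proj₁ chain
      x-top : ∀ z → z ≤ x (fromℕ r)
      x-top = proj₁ (proj₂ chain)
      x-covers : ∀ k → x (inject₁ k) ≺ x (suc k)
      x-covers = proj₁ (proj₂ (proj₂ chain))
      x-leftModular : ∀ i → IsLeftModular (x i)
      x-leftModular = proj₂ (proj₂ (proj₂ chain))

    cover-IsModularTriple : ∀ w k → IsModularTriple (x (inject₁ k)) w (x (suc k))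
    cover-IsModularTriple w k = [ id , (λ flat → ⊥-elim (<-irrefl total (too-short flat))) ]′ (modular⊎flat k)
      where
      splits : ∀ k → CoverSplit (x (inject₁ k)) (x (suc k)) w
      splits k = coverSplit (x-covers k) (x-leftModular _) (x-leftModular _) w
      open module Split (i : Fin r) = CoverSplit (splits i)

      stepLength : Fin r → ℕ
      stepLength i = lowerLength i ℕ.+ upperLength i

      too-short : stepLength k ≡ 0 → sum stepLength ℕ.< r
      too-short = sum<length stepLength length≤1 k

      w-between : w ∨ x zero ≈ x (fromℕ r) ∧ w
      w-between = Eq.trans (antisym (∨-least refl (x-bottom w)) (x≤x∨y _ _))
                           (antisym (∧-greatest (x-top w) refl) (x∧y≤y _ _))

      walk : MaxChain (x zero) (x (fromℕ r)) (sum lowerLength ℕ.+ (sum upperLength ℕ.+ 0))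
      walk = MaxChain-respˡ (antisym (x∧y≤x _ _) (∧-greatest refl (x-bottom w)))
               (Steps-prepend (λ i → x i ∧ w) lowerLength lower
                 (MaxChain-respˡ w-between
                   (Steps-prepend (λ i → w ∨ x i) upperLength upper
                     (MaxChain-respʳ (antisym (∨-least (x-top w) refl) (y≤x∨y _ _)) MaxChain-refl))))

      x₀<xᵣ : x zero < x (fromℕ r)
      x₀<xᵣ = x-bottom _ , λ x₀≈xᵣ →
        ≺⇒≱ (x-covers k) (trans (x-top _) (trans (reflexive (Eq.sym x₀≈xᵣ)) (x-bottom _)))

      total : sum stepLength ≡ r
      total = ≡.trans (∑-distrib-+ lowerLength upperLength)
               (≡.trans (≡.cong (sum lowerLength ℕ.+_) (≡.sym (+-identityʳ (sum upperLength))))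
                 (graded _ _ x₀<xᵣ _ r walk (x , Eq.refl , Eq.refl , x-covers)))

    chain-IsModularTriple : ∀ w {i j} → i F.≤ j → x i ≤ x j × IsModularTriple (x i) w (x j)
    chain-IsModularTriple w = steps⇒IsModularTriple x x-leftModular
                                (λ k → proj₁ (proj₁ (x-covers k)) , cover-IsModularTriple w k)

    InChain : Carrier → Set ℓ₁
    InChain u = ∃ λ i → u ≈ x i

    chain-isModularFamily : IsModularFamily InChain
    chain-isModularFamily = record
      { leftModular = λ (i , u≈xᵢ) → IsLeftModular-resp-≈ (Eq.sym u≈xᵢ) (x-leftModular i)
      ; modularPair = modularPair
      }
      where
      modularPair : ∀ {s t} → InChain s → InChain t → s ≤ t → ∀ w → IsModularTriple s w t
      modularPair (i , s≈xᵢ) (j , t≈xⱼ) _ w with ≤-total i j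
      ... | inj₁ i≤j = IsModularTriple-resp-≈ (Eq.sym s≈xᵢ) (Eq.sym t≈xⱼ)
                                              (proj₂ (chain-IsModularTriple w i≤j))
      ... | inj₂ j≤i = ≥⇒IsModularTriple (trans (reflexive t≈xⱼ)
                         (trans (proj₁ (chain-IsModularTriple w j≤i)) (reflexive (Eq.sym s≈xᵢ))))

  Decreasing Increasing : ∀ {n} → (Fin n → Carrier) → Set ℓ₂
  Decreasing a = ∀ i j → i F.≤ j → a j ≤ a i
  Increasing b = ∀ i j → i F.≤ j → b i ≤ b j

  Decreasing-tail : ∀ {n} {a : Fin (suc n) → Carrier} → Decreasing a → Decreasing (a ∘ suc)
  Decreasing-tail decreasing i j i≤j = decreasing (suc i) (suc j) (ℕ.s≤s i≤j)

  Increasing-tail : ∀ {n} {b : Fin (suc n) → Carrier} → Increasing b → Increasing (b ∘ suc)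
  Increasing-tail increasing i j i≤j = increasing (suc i) (suc j) (ℕ.s≤s i≤j)

  shiftJoin≤head : ∀ n (a b : Fin (suc n) → Carrier) → Decreasing a → shiftJoin n a b ≤ a zero
  shiftJoin≤head ℕ.zero  a b decreasing = refl
  shiftJoin≤head (suc n) a b decreasing =
    ∨-least (x∧y≤x _ _) (trans (shiftJoin≤head n (a ∘ suc) (b ∘ suc) (Decreasing-tail decreasing))
                                (decreasing zero (suc zero) ℕ.z≤n))

  head≤shiftMeet : ∀ n (a b : Fin (suc n) → Carrier) → Increasing b → b zero ≤ shiftMeet n a b
  head≤shiftMeet ℕ.zero  a b increasing = refl
  head≤shiftMeet (suc n) a b increasing =
    ∧-greatest (x≤x∨y _ _) (trans (increasing zero (suc zero) ℕ.z≤n)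
                                  (head≤shiftMeet n (a ∘ suc) (b ∘ suc) (Increasing-tail increasing)))

  module _ {p} {M : Carrier → Set p} (family : IsModularFamily M) where
    open IsModularFamily family

    shiftJoin-IsModularTriple :
      ∀ n (a b : Fin (suc n) → Carrier) → (∀ i → M (a i)) → Decreasing a → Increasing b →
      ∀ {e c} → M e → a zero ≤ e → c ≤ b zero → IsModularTriple (shiftJoin n a b) c e
    shiftJoin-IsModularTriple ℕ.zero a b a∈M _ _ e∈M a₀≤e _ = modularPair (a∈M zero) e∈M a₀≤e _
    shiftJoin-IsModularTriple (suc n) a b a∈M decreasing increasing {e} {c} e∈M a₀≤e c≤b₀ = begin
      e ∧ (c ∨ S)                            ≤⟨ ∧-greatest (trans (∧-monotonic refl (∨-monotonic refl S≤a₀))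
                                                                  (modularPair (a∈M zero) e∈M a₀≤e c))
                                                           (x∧y≤y _ _) ⟩
      ((e ∧ c) ∨ a₀) ∧ (c ∨ S)               ≈⟨ leftModular (a∈M zero) (e ∧ c) (c ∨ S)
                                                  (trans (x∧y≤y _ _) (x≤x∨y _ _)) ⟩
      (e ∧ c) ∨ (a₀ ∧ (c ∨ S))               ≈⟨ ∨-cong Eq.refl (∧-cong Eq.refl (Eq.sym (∨-assoc _ _ _))) ⟩
      (e ∧ c) ∨ (a₀ ∧ (c′ ∨ S′))             ≤⟨ ∨-monotonic refl IH ⟩
      (e ∧ c) ∨ ((a₀ ∧ c′) ∨ S′)             ≤⟨ ∨-monotonic refl (∨-monotonic (∧-monotonic refl c′≤b₁) refl) ⟩
      (e ∧ c) ∨ ((a₀ ∧ b (suc zero)) ∨ S′)   ∎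
      where
      open ≤-Reasoning
      a₀ = a zero
      S = shiftJoin (suc n) a b
      S′ = shiftJoin n (a ∘ suc) (b ∘ suc)
      S≤a₀ : S ≤ a₀
      S≤a₀ = shiftJoin≤head (suc n) a b decreasing
      c′ = c ∨ (a₀ ∧ b (suc zero))
      c′≤b₁ : c′ ≤ b (suc zero)
      c′≤b₁ = ∨-least (trans c≤b₀ (increasing zero (suc zero) ℕ.z≤n)) (x∧y≤y _ _)
      IH : IsModularTriple S′ c′ a₀
      IH = shiftJoin-IsModularTriple n (a ∘ suc) (b ∘ suc) (a∈M ∘ suc)
             (Decreasing-tail decreasing) (Increasing-tail increasing)
             (a∈M zero) (decreasing zero (suc zero) ℕ.z≤n) c′≤b₁

    meetPairs-≈ : ∀ n (a b : Fin (suc n) → Carrier) → (∀ i → M (a i)) → Decreasing a → Increasing b →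
                  meetPairs n a b ≈ b zero ∨ shiftJoin n a b
    meetPairs-≈ ℕ.zero a b _ _ _ = Eq.refl
    meetPairs-≈ (suc n) a b a∈M decreasing increasing = begin
      (b₀ ∨ a₀) ∧ meetPairs n a′ b′  ≈⟨ ∧-cong Eq.refl (meetPairs-≈ n a′ b′ (a∈M ∘ suc) decreasing′ increasing′) ⟩
      (b₀ ∨ a₀) ∧ (b₁ ∨ S′)          ≈⟨ leftModular (a∈M zero) b₀ (b₁ ∨ S′)
                                          (trans (increasing zero (suc zero) ℕ.z≤n) (x≤x∨y _ _)) ⟩
      b₀ ∨ (a₀ ∧ (b₁ ∨ S′))          ≈⟨ ∨-cong Eq.refl (IsModularTriple⇒≈ S′≤a₀
                                          (shiftJoin-IsModularTriple n a′ b′ (a∈M ∘ suc) decreasing′ increasing′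
                                             (a∈M zero) a₁≤a₀ refl)) ⟩
      b₀ ∨ ((a₀ ∧ b₁) ∨ S′)          ∎
      where
      open ≈-Reasoning
      a′ = a ∘ suc
      b′ = b ∘ suc
      a₀ = a zero
      b₀ = b zero
      b₁ = b (suc zero)
      S′ = shiftJoin n a′ b′
      decreasing′ = Decreasing-tail decreasing
      increasing′ = Increasing-tail increasing
      a₁≤a₀ : a (suc zero) ≤ a₀
      a₁≤a₀ = decreasing zero (suc zero) ℕ.z≤n
      S′≤a₀ : S′ ≤ a₀
      S′≤a₀ = trans (shiftJoin≤head n a′ b′ decreasing′) a₁≤a₀

    joinPairs-≈ : ∀ n (a b : Fin (suc n) → Carrier) → (∀ i → M (a i)) → Decreasing a → Increasing b →
                  joinPairs n a b ≈ a zero ∧ shiftMeet n a b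
    joinPairs-≈ ℕ.zero a b _ _ _ = Eq.refl
    joinPairs-≈ (suc n) a b a∈M decreasing increasing = begin
      (a₀ ∧ b₀) ∨ joinPairs n a′ b′  ≈⟨ ∨-cong Eq.refl (joinPairs-≈ n a′ b′ (a∈M ∘ suc) decreasing′ increasing′) ⟩
      (a₀ ∧ b₀) ∨ (a₁ ∧ T′)          ≈⟨ Eq.sym (leftModular (a∈M (suc zero)) (a₀ ∧ b₀) T′ a₀∧b₀≤T′) ⟩
      ((a₀ ∧ b₀) ∨ a₁) ∧ T′          ≈⟨ ∧-cong (Eq.sym (IsModularTriple⇒≈ a₁≤a₀
                                          (modularPair (a∈M (suc zero)) (a∈M zero) a₁≤a₀ b₀))) Eq.refl ⟩
      (a₀ ∧ (b₀ ∨ a₁)) ∧ T′          ≈⟨ ∧-assoc _ _ _ ⟩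
      a₀ ∧ ((b₀ ∨ a₁) ∧ T′)          ∎
      where
      open ≈-Reasoning
      a′ = a ∘ suc
      b′ = b ∘ suc
      a₀ = a zero
      a₁ = a (suc zero)
      b₀ = b zero
      T′ = shiftMeet n a′ b′
      decreasing′ = Decreasing-tail decreasing
      increasing′ = Increasing-tail increasing
      a₁≤a₀ : a₁ ≤ a₀
      a₁≤a₀ = decreasing zero (suc zero) ℕ.z≤n
      a₀∧b₀≤T′ : a₀ ∧ b₀ ≤ T′
      a₀∧b₀≤T′ = trans (x∧y≤y _ _) (trans (increasing zero (suc zero) ℕ.z≤n)
                                          (head≤shiftMeet n a′ b′ increasing′))

lemma9 : ∀ {c ℓ₁ ℓ₂} (L : Lattice c ℓ₁ ℓ₂) → let open LatticeDefs L in
    IsFinite → IsGraded →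
    (r : ℕ) (x : Fin (suc r) → Carrier) → IsMaxLeftModularChain r x →
    (Y : Carrier → Set c) → IsChain Y →
    (n : ℕ) (a b : Fin (suc n) → Carrier) →
    (∀ i → ∃ λ j → a i ≈ x j) → (∀ i j → i F.≤ j → a j ≤ a i) →
    (∀ i → Y (b i)) → (∀ i j → i F.≤ j → b i ≤ b j) →
    (meetPairs n a b ≈ (b F.zero ∨ shiftJoin n a b))
      × (joinPairs n a b ≈ (a F.zero ∧ shiftMeet n a b))
lemma9 L _ graded r x chain _ _ n a b a∈x decreasing _ increasing =
  meetPairs-≈ family n a b a∈x decreasing increasing ,
  joinPairs-≈ family n a b a∈x decreasing increasing
  where
  open LeftModularChain L
  family = chain-isModularFamily graded chain
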